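{- Every finite almost $\mathcal R$-trivial monoid $M$ is aperiodic and has linear $\mathbb X_{\mathcal R}(M)$.
   Context: $a\,\mathcal R\, b$ iff $aM=bM$. $M$ is almost $\mathcal R$-trivial if for every $\mathcal R$-class $[a]_{\mathcal R}$ with more than one element, $Ma=\{a\}$. $M$ is aperiodic if for every $a$ there is $n$ with $a^n=a^{n+1}$. $\mathbb X_{\mathcal R}(M)=\{aM:[a]_{\mathcal R}\text{ has more than one element}\}$, linear if linearly ordered by inclusion. -}

module Defs where

open import Level using (Level; _⊔_)
open import Algebra.Bundles using (Monoid)
open import Data.Nat using (ℕ; zero; suc)
open import Data.Fin using (Fin)
open import Data.Product using (Σ; ∃; _×_)
open import Data.Sum using (_⊎_)
open import Relation.Nullary using (¬_)
open import Function.Bundles using (Bijection)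
import Relation.Binary.PropositionalEquality as ≡

module _ {c ℓ : Level} (M : Monoid c ℓ) where
  open Monoid M

  IsFinite : Set (c ⊔ ℓ)
  IsFinite = Σ ℕ λ n → Bijection (≡.setoid (Fin n)) setoid

  _⊆R_ : Carrier → Carrier → Set (c ⊔ ℓ)
  a ⊆R b = ∀ x → ∃ λ y → a ∙ x ≈ b ∙ y

  _R_ : Carrier → Carrier → Set (c ⊔ ℓ)
  a R b = (a ⊆R b) × (b ⊆R a)

  NontrivialRClass : Carrier → Set (c ⊔ ℓ)
  NontrivialRClass a = ∃ λ b → (a R b) × ¬ (a ≈ b)

  AlmostRTrivial : Set (c ⊔ ℓ)
  AlmostRTrivial = ∀ a → NontrivialRClass a → ∀ m → m ∙ a ≈ a

  pow : Carrier → ℕ → Carrier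
  pow a zero = ε
  pow a (suc n) = a ∙ pow a n

  Aperiodic : Set (c ⊔ ℓ)
  Aperiodic = ∀ a → ∃ λ n → pow a n ≈ pow a (suc n)

  -- X_R(M) = { aM : [a]_R nontrivial } is linearly ordered by inclusion
  LinearXR : Set (c ⊔ ℓ)
  LinearXR = ∀ a b → NontrivialRClass a → NontrivialRClass b →
             (a ⊆R b) ⊎ (b ⊆R a)

-- Linearity: if [a]_R is nontrivial then a = b a for every b, so aM ⊆ bM.
-- Aperiodicity: by finiteness some power repeats, a^i = a^(i+1+d); then
-- a^i R a^(i+1), and a^i R a·a^i forces a^i = a·a^i, since otherwise
-- [a^i]_R is nontrivial and M fixes a^i. Finiteness also makes equality
-- decidable, which this case split needs constructively.
module Submission where

open import Defs
open import Level using (Level)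
open import Algebra.Bundles using (Monoid)
open import Data.Product using (_×_; _,_; ∃₂)
open import Data.Sum using (inj₁)
open import Data.Nat using (ℕ; zero; suc; _+_)
open import Data.Nat.Properties using (m≤n⇒∃[o]m+o≡n; n<1+n; +-comm)
open import Data.Fin using (Fin; toℕ)
open import Data.Fin.Properties using (pigeonhole; inj⇒≟)
open import Function.Bundles using (Bijection; Injection)
open import Function.Properties.Bijection using (Bijection⇒Inverse)
open import Function.Properties.Inverse using (Inverse⇒Injection)
open import Function.Construct.Symmetry using (inverse)
open import Relation.Binary.Bundles using (Setoid)
open import Relation.Binary.Definitions using (Decidable)
open import Relation.Nullary using (yes; no)
import Relation.Binary.PropositionalEquality as ≡
import Relation.Binary.Reasoning.Setoid as ≈-Reasoning

module FiniteSetoid {c ℓ} (S : Setoid c ℓ) {n : ℕ} (fin : Bijection (≡.setoid (Fin n)) S) where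
  open Setoid S

  private
    index : Injection S (≡.setoid (Fin n))
    index = Inverse⇒Injection (inverse (Bijection⇒Inverse fin))
    open Injection index using (to; injective)

  decidable : Decidable _≈_
  decidable = inj⇒≟ index

  repetition : (f : ℕ → Carrier) → ∃₂ λ i d → f i ≈ f (suc i + d)
  repetition f with pigeonhole (n<1+n n) (λ k → to (f (toℕ k)))
  ... | i , j , i<j , toᵢ≡toⱼ with m≤n⇒∃[o]m+o≡n i<j
  ... | d , 1+i+d≡j = toℕ i , d , ≡.subst (λ k → f (toℕ i) ≈ f k) (≡.sym 1+i+d≡j) (injective toᵢ≡toⱼ)

module _ {c ℓ : Level} (M : Monoid c ℓ) where
  open Monoid M
  open ≈-Reasoning setoid

  private
    infix 4 _⊆_ _ℛ_
    _⊆_ _ℛ_ : Carrier → Carrier → Set _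
    _⊆_ = _⊆R_ M
    _ℛ_ = _R_ M

    infixr 8 _^_
    _^_ : Carrier → ℕ → Carrier
    a ^ k = pow M a k

  ^-homo-+ : ∀ a i d → a ^ (i + d) ≈ a ^ i ∙ a ^ d
  ^-homo-+ a zero    d = sym (identityˡ (a ^ d))
  ^-homo-+ a (suc i) d = begin
    a ∙ a ^ (i + d)     ≈⟨ ∙-congˡ (^-homo-+ a i d) ⟩
    a ∙ (a ^ i ∙ a ^ d) ≈⟨ assoc a (a ^ i) (a ^ d) ⟨
    a ^ suc i ∙ a ^ d   ∎

  ∙-⊆R : ∀ x y → x ∙ y ⊆ x
  ∙-⊆R x y z = y ∙ z , assoc x y z

  ⊆R-respˡ-≈ : ∀ {x x′ y} → x ≈ x′ → x′ ⊆ y → x ⊆ y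
  ⊆R-respˡ-≈ x≈x′ x′⊆y z with x′⊆y z
  ... | w , x′z≈yw = w , trans (∙-congʳ x≈x′) x′z≈yw

  ^-+-⊆R : ∀ a i d → a ^ (i + d) ⊆ a ^ i
  ^-+-⊆R a i d = ⊆R-respˡ-≈ (^-homo-+ a i d) (∙-⊆R (a ^ i) (a ^ d))

  ^-suc-⊆R : ∀ a i → a ^ suc i ⊆ a ^ i
  ^-suc-⊆R a i = ≡.subst (λ k → a ^ k ⊆ a ^ i) (+-comm i 1) (^-+-⊆R a i 1)

  ^-repeat⇒R : ∀ a i d → a ^ i ≈ a ^ (suc i + d) → a ^ i ℛ a ^ suc i
  ^-repeat⇒R a i d aⁱ≈ = ⊆R-respˡ-≈ aⁱ≈ (^-+-⊆R a (suc i) d) , ^-suc-⊆R a i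

  module _ (art : AlmostRTrivial M) where

    nontrivial⇒⊆R : ∀ {a} → NontrivialRClass M a → ∀ b → a ⊆ b
    nontrivial⇒⊆R {a} na b = ⊆R-respˡ-≈ (sym (art a na b)) (∙-⊆R b a)

    almostRTrivial⇒linearXR : LinearXR M
    almostRTrivial⇒linearXR a b na nb = inj₁ (nontrivial⇒⊆R na b)

    R-∙ˡ⇒≈ : Decidable _≈_ → ∀ {m x} → x ℛ m ∙ x → x ≈ m ∙ x
    R-∙ˡ⇒≈ ≈-dec {m} {x} xRmx with ≈-dec x (m ∙ x)
    ... | yes x≈mx = x≈mx
    ... | no x≉mx = sym (art x (m ∙ x , xRmx , x≉mx) m)

    finite∧almostRTrivial⇒aperiodic : IsFinite M → Aperiodic M
    finite∧almostRTrivial⇒aperiodic (_ , fin) a with FiniteSetoid.repetition setoid fin (a ^_)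
    ... | i , d , aⁱ≈aⁱ⁺¹⁺ᵈ =
      i , R-∙ˡ⇒≈ (FiniteSetoid.decidable setoid fin) (^-repeat⇒R a i d aⁱ≈aⁱ⁺¹⁺ᵈ)

proposition2p5 : {c ℓ : Level} (M : Monoid c ℓ) → IsFinite M → AlmostRTrivial M →
                   Aperiodic M × LinearXR M
proposition2p5 M fin art =
  finite∧almostRTrivial⇒aperiodic M art fin , almostRTrivial⇒linearXR M art
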